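{- Let $T$ be a binary tree and let $n_1$ denote the number of vertices of degree one in $T$. Then $tvs(T)=\left\lceil \tfrac{n_1+1}{2}\right\rceil$.
   Context: A binary tree here is a (full) rooted binary tree: a rooted tree in which every non-leaf vertex has exactly two children; thus every vertex has degree $1$ or $3$, except the root, which has degree $2$ (when the tree has more than one vertex). All graphs are finite, simple and undirected. A total weighting of a graph $G$ with labels in $\{1,\dots,s\}$ is a map $w: V(G)\cup E(G)\to\{1,2,\dots,s\}$. The weighted degree of a vertex $v$ is $wt_G(v)=w(v)+\sum_{e\in E(G),\, v\in e} w(e)$. The weighting is irregular if $wt_G(u)\neq wt_G(v)$ for every pair of distinct vertices $u,v$. The total vertex irregularity strength $tvs(G)$ is the smallest integer $s$ such that $G$ admits an irregular total weighting with labels in $\{1,2,\dots,s\}$. -}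

module Defs where

open import Data.Nat using (ℕ; zero; suc; _+_; _≤_; _≟_)
open import Data.Fin using (Fin; zero; suc; _↑ˡ_; _↑ʳ_)
import Data.Fin as F
open import Data.List using (List; []; _∷_; _++_; map; length; filter; allFin)
open import Data.Product using (Σ; _×_; _,_)
open import Data.Bool using (if_then_else_; _∨_)
open import Relation.Nullary using (does)
open import Relation.Binary.PropositionalEquality using (_≡_)

-- Finite undirected graphs: vertex set Fin n, a list of edges
-- (each edge an unordered pair {a , b}, stored as a pair).

record Graph : Set where
  field
    n : ℕ
    E : List (Fin n × Fin n)
open Graph public

incSum : ∀ {k} (E : List (Fin k × Fin k)) → (Fin (length E) → ℕ) → Fin k → ℕ
incSum [] w v = 0
incSum ((a , b) ∷ E) w v =
  (if does (a F.≟ v) ∨ does (b F.≟ v) then w zero else 0) + incSum E (λ i → w (suc i)) v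

degree : (G : Graph) → Fin (n G) → ℕ
degree G v = incSum (E G) (λ _ → 1) v

n₁ : Graph → ℕ
n₁ G = length (filter (λ v → degree G v ≟ 1) (allFin (n G)))

record TotalWeighting (G : Graph) : Set where
  field
    wV : Fin (n G) → ℕ
    wE : Fin (length (E G)) → ℕ
open TotalWeighting public

wt : {G : Graph} → TotalWeighting G → Fin (n G) → ℕ
wt {G} w v = wV w v + incSum (E G) (wE w) v

LabelsIn : {G : Graph} → ℕ → TotalWeighting G → Set
LabelsIn {G} s w =
  ((v : Fin (n G)) → 1 ≤ wV w v × wV w v ≤ s) ×
  ((e : Fin (length (E G))) → 1 ≤ wE w e × wE w e ≤ s)

Irregular : {G : Graph} → TotalWeighting G → Set
Irregular {G} w = (u v : Fin (n G)) → wt w u ≡ wt w v → u ≡ v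

HasIrregularWeighting : Graph → ℕ → Set
HasIrregularWeighting G s = Σ (TotalWeighting G) λ w → LabelsIn s w × Irregular w

IsTvs : Graph → ℕ → Set
IsTvs G s = HasIrregularWeighting G s × ((s' : ℕ) → HasIrregularWeighting G s' → s ≤ s')

data BTree : Set where
  leaf : BTree
  node : BTree → BTree → BTree

size : BTree → ℕ
size leaf = 1
size (node l r) = suc (size l + size r)

root : (t : BTree) → Fin (size t)
root leaf = zero
root (node l r) = zero

-- vertex numbering: root = 0, then the left subtree, then the right subtree
treeEdges : (t : BTree) → List (Fin (size t) × Fin (size t))
treeEdges leaf = []
treeEdges (node l r) =
  (zero , inL (root l)) ∷ (zero , inR (root r)) ∷
  (map (λ { (a , b) → inL a , inL b }) (treeEdges l) ++
   map (λ { (a , b) → inR a , inR b }) (treeEdges r))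
  where
  inL : Fin (size l) → Fin (size (node l r))
  inL i = suc (i ↑ˡ size r)
  inR : Fin (size r) → Fin (size (node l r))
  inR i = suc (size l ↑ʳ i)

treeGraph : BTree → Graph
treeGraph t = record { n = size t ; E = treeEdges t }

module Submission where

-- Lower bound (any graph with a vertex): with labels in [1,s'] a vertex of degree
-- one has weighted degree in [2, 2s'], and these must be distinct, so n₁ ≤ 2s' - 1.
--
-- Upper bound (construction): write the weight of the edge from a vertex x to its
-- parent as an "up-weight" of x, so that a weighted degree is the vertex weight plus
-- the up-weights of the vertex and of its children (the load).  Classify internal
-- vertices as cherries (two leaf children, c of them), twigs (one leaf child, m of
-- them) and forks (c - 1 of them); then n₁ = 2c + m.  A recursive numbering assigns
-- every non-root vertex a code (class and index), and a fixed table gives the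
-- vertex weight and up-weight of each code.  The resulting weighted degrees lie in
-- disjoint windows (cherry leaves, twig leaves, root, cherries, twigs, forks) and
-- can be decoded, so distinct codes have distinct weighted degrees.

open import Defs
open import Data.Nat using (ℕ; zero; suc; _+_; _∸_; _≤_; _<_; z≤n; s≤s; s≤s⁻¹; _⊔_; ⌈_/2⌉; ⌊_/2⌋; _≟_; _≤?_; _≤ᵇ_)
open import Data.Nat.Properties
open import Data.Nat.Solver using (module +-*-Solver)
open +-*-Solver using (solve; _:+_; _:=_; con)
open import Data.Fin using (Fin; zero; suc; _↑ˡ_; _↑ʳ_; splitAt; toℕ; fromℕ<)
import Data.Fin as F
import Data.Fin.Properties as FP
open import Data.List using (List; []; _∷_; _++_; map; length; lookup; filter; allFin; tabulate)
open import Data.List.Relation.Unary.All as All using (All; []; _∷_)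
import Data.List.Relation.Unary.All.Properties as AllP
open import Data.List.Relation.Unary.AllPairs using (_∷_)
open import Data.List.Relation.Unary.Unique.Propositional using (Unique)
import Data.List.Relation.Unary.Unique.Propositional.Properties as UniqueP
open import Data.List.Membership.Propositional.Properties using (∈-lookup; ∈-filter⁻)
open import Data.Maybe using (Maybe; just; nothing)
open import Data.Maybe.Properties using (just-injective)
open import Data.Product using (_×_; _,_; proj₁; proj₂)
open import Data.Sum using (inj₁; inj₂; [_,_]′)
open import Data.Bool using (Bool; true; false; if_then_else_; _∨_; T)
open import Data.Unit using (tt)
open import Data.Empty using (⊥; ⊥-elim)
open import Relation.Nullary using (Dec; does; yes; no)
open import Relation.Nullary.Decidable using (dec-true; dec-false)
open import Relation.Binary.PropositionalEquality
open import Function using (_∘_)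
open import Function.Definitions using (Injective)

Bounded : ℕ → ℕ → Set
Bounded s x = 1 ≤ x × x ≤ s

incSum-isolated : ∀ {k} (E : List (Fin k × Fin k)) w v → incSum E (λ _ → 1) v ≡ 0 → incSum E w v ≡ 0
incSum-isolated [] w v deg0 = refl
incSum-isolated ((a , b) ∷ E) w v deg0 with does (a F.≟ v) ∨ does (b F.≟ v)
... | false = incSum-isolated E (w ∘ suc) v deg0

incSum-pendant : ∀ (P : ℕ → Set) {k} (E : List (Fin k × Fin k)) w v →
  (∀ e → P (w e)) → incSum E (λ _ → 1) v ≡ 1 → P (incSum E w v)
incSum-pendant P ((a , b) ∷ E) w v Pw deg1 with does (a F.≟ v) ∨ does (b F.≟ v)
... | true = subst P (sym (trans (cong (w zero +_) (incSum-isolated E (w ∘ suc) v (suc-injective deg1))) (+-identityʳ _))) (Pw zero)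
... | false = incSum-pendant P E (w ∘ suc) v (Pw ∘ suc) deg1

pendant-wt : ∀ {G : Graph} {s} (w : TotalWeighting G) → LabelsIn s w →
  ∀ v → degree G v ≡ 1 → 2 ≤ wt w v × wt w v ≤ s + s
pendant-wt {G} w (bv , be) v deg1 =
  +-mono-≤ (proj₁ (bv v)) (proj₁ edge) , +-mono-≤ (proj₂ (bv v)) (proj₂ edge)
  where edge = incSum-pendant (Bounded _) (E G) (wE w) v be deg1

lookup-injective : ∀ {A : Set} {xs : List A} → Unique xs → ∀ {i j} → lookup xs i ≡ lookup xs j → i ≡ j
lookup-injective (_ ∷ _) {zero} {zero} _ = refl
lookup-injective (x∉ ∷ _) {zero} {suc j} eq = ⊥-elim (All.lookup x∉ (∈-lookup j) eq)
lookup-injective (x∉ ∷ _) {suc i} {zero} eq = ⊥-elim (All.lookup x∉ (∈-lookup i) (sym eq))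
lookup-injective (_ ∷ u) {suc i} {suc j} eq = cong suc (lookup-injective u eq)

below-pred : ∀ {x N} → 2 ≤ x → x ≤ N → x ∸ 2 < N ∸ 1
below-pred {suc (suc x)} (s≤s (s≤s z≤n)) x≤N = ∸-monoˡ-≤ 1 x≤N

lower-bound : ∀ (G : Graph) → Fin (n G) → ∀ s → HasIrregularWeighting G s → ⌈ suc (n₁ G) /2⌉ ≤ s
lower-bound G v₀ s (w , labels , irr) = begin
    ⌈ suc (n₁ G) /2⌉  ≤⟨ ⌈n/2⌉-mono (subst (suc (n₁ G) ≤_) (trans (+-comm 1 _) (m∸n+n≡m 1≤2s)) (s≤s few)) ⟩
    ⌈ s + s /2⌉       ≡⟨ sym (n≡⌈n+n/2⌉ s) ⟩
    s                 ∎
  where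
  open ≤-Reasoning
  1≤2s : 1 ≤ s + s
  1≤2s = ≤-trans (≤-trans (proj₁ (proj₁ labels v₀)) (proj₂ (proj₁ labels v₀))) (m≤m+n s s)
  pendants = filter (λ v → degree G v ≟ 1) (allFin (n G))
  pendant : ∀ i → 2 ≤ wt w (lookup pendants i) × wt w (lookup pendants i) ≤ s + s
  pendant i = pendant-wt w labels _ (proj₂ (∈-filter⁻ (λ v → degree G v ≟ 1) {xs = allFin (n G)} (∈-lookup i)))
  code : Fin (length pendants) → Fin (s + s ∸ 1)
  code i = fromℕ< (below-pred (proj₁ (pendant i)) (proj₂ (pendant i)))
  code-injective : ∀ {i j} → code i ≡ code j → i ≡ j
  code-injective {i} {j} eq = lookup-injective (UniqueP.filter⁺ _ (UniqueP.allFin⁺ (n G))) (irr _ _ (begin-equality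
      wt w (lookup pendants i)           ≡⟨ sym (m∸n+n≡m (proj₁ (pendant i))) ⟩
      wt w (lookup pendants i) ∸ 2 + 2   ≡⟨ cong (_+ 2) (trans (sym (FP.toℕ-fromℕ< _)) (trans (cong toℕ eq) (FP.toℕ-fromℕ< _))) ⟩
      wt w (lookup pendants j) ∸ 2 + 2   ≡⟨ m∸n+n≡m (proj₁ (pendant j)) ⟩
      wt w (lookup pendants j)           ∎))
  few : n₁ G ≤ s + s ∸ 1
  few = FP.injective⇒≤ code-injective

does-injective : ∀ {m n} (f : Fin m → Fin n) → (∀ {a b} → f a ≡ f b → a ≡ b) →
  ∀ a b → does (f a F.≟ f b) ≡ does (a F.≟ b)
does-injective f inj a b with a F.≟ b
... | yes refl = dec-true (f a F.≟ f a) refl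
... | no a≢b = dec-false (f a F.≟ f b) (a≢b ∘ inj)

inL : ∀ l r → Fin (size l) → Fin (size (node l r))
inL l r i = suc (i ↑ˡ size r)

inR : ∀ l r → Fin (size r) → Fin (size (node l r))
inR l r j = suc (size l ↑ʳ j)

inL-injective : ∀ l r {i i'} → inL l r i ≡ inL l r i' → i ≡ i'
inL-injective l r {i} {i'} eq = FP.↑ˡ-injective (size r) i i' (FP.suc-injective eq)

inR-injective : ∀ l r {j j'} → inR l r j ≡ inR l r j' → j ≡ j'
inR-injective l r {j} {j'} eq = FP.↑ʳ-injective (size l) j j' (FP.suc-injective eq)

↑ˡ≢↑ʳ : ∀ m n (a : Fin m) (b : Fin n) → a ↑ˡ n ≢ m ↑ʳ b
↑ˡ≢↑ʳ (suc m) n (suc a) b eq = ↑ˡ≢↑ʳ m n a b (FP.suc-injective eq)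

inL≢inR : ∀ l r i j → inL l r i ≢ inR l r j
inL≢inR l r i j eq = ↑ˡ≢↑ʳ (size l) (size r) i j (FP.suc-injective eq)

caseV : ∀ {A : Set} l r → A → (Fin (size l) → A) → (Fin (size r) → A) → Fin (size (node l r)) → A
caseV l r a f g zero = a
caseV l r a f g (suc j) = [ f , g ]′ (splitAt (size l) j)

caseV-inL : ∀ {A : Set} l r (a : A) f g i → caseV l r a f g (inL l r i) ≡ f i
caseV-inL l r a f g i rewrite FP.splitAt-↑ˡ (size l) i (size r) = refl

caseV-inR : ∀ {A : Set} l r (a : A) f g j → caseV l r a f g (inR l r j) ≡ g j
caseV-inR l r a f g j rewrite FP.splitAt-↑ʳ (size l) (size r) j = refl

data Vertex (l r : BTree) : Fin (size (node l r)) → Set where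
  atRoot : Vertex l r zero
  inLeft : (i : Fin (size l)) → Vertex l r (inL l r i)
  inRight : (j : Fin (size r)) → Vertex l r (inR l r j)

vertex : ∀ l r v → Vertex l r v
vertex l r zero = atRoot
vertex l r (suc j) with splitAt (size l) j in eq
... | inj₁ i = subst (Vertex l r ∘ suc) (FP.splitAt⁻¹-↑ˡ eq) (inLeft i)
... | inj₂ i = subst (Vertex l r ∘ suc) (FP.splitAt⁻¹-↑ʳ eq) (inRight i)

caseV-all : ∀ {A : Set} (P : A → Set) l r {a f g} → P a → (∀ i → P (f i)) → (∀ j → P (g j)) →
  ∀ v → P (caseV l r a f g v)
caseV-all P l r {a} {f} {g} pa pf pg v with vertex l r v
... | atRoot = pa
... | inLeft i = subst P (sym (caseV-inL l r a f g i)) (pf i)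
... | inRight j = subst P (sym (caseV-inR l r a f g j)) (pg j)

caseV-injective : ∀ {A : Set} l r {a : A} {f g} →
  Injective _≡_ _≡_ f → Injective _≡_ _≡_ g →
  (∀ i → f i ≢ a) → (∀ j → g j ≢ a) → (∀ i j → f i ≢ g j) → Injective _≡_ _≡_ (caseV l r a f g)
caseV-injective l r {a} {f} {g} f-inj g-inj fa ga fg {u} {v} = go (vertex l r u) (vertex l r v)
  where
  cL : ∀ i → caseV l r a f g (inL l r i) ≡ f i
  cL i = caseV-inL l r a f g i
  cR : ∀ j → caseV l r a f g (inR l r j) ≡ g j
  cR j = caseV-inR l r a f g j
  go : ∀ {u v} → Vertex l r u → Vertex l r v → caseV l r a f g u ≡ caseV l r a f g v → u ≡ v
  go atRoot atRoot eq = refl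
  go atRoot (inLeft i) eq = ⊥-elim (fa i (sym (trans eq (cL i))))
  go atRoot (inRight j) eq = ⊥-elim (ga j (sym (trans eq (cR j))))
  go (inLeft i) atRoot eq = ⊥-elim (fa i (trans (sym (cL i)) eq))
  go (inRight j) atRoot eq = ⊥-elim (ga j (trans (sym (cR j)) eq))
  go (inLeft i) (inLeft i') eq = cong (inL l r) (f-inj (trans (sym (cL i)) (trans eq (cL i'))))
  go (inRight j) (inRight j') eq = cong (inR l r) (g-inj (trans (sym (cR j)) (trans eq (cR j'))))
  go (inLeft i) (inRight j) eq = ⊥-elim (fg i j (trans (sym (cL i)) (trans eq (cR j))))
  go (inRight j) (inLeft i) eq = ⊥-elim (fg i j (trans (sym (cL i)) (trans (sym eq) (cR j))))

caseV-cong : ∀ {A : Set} l r {a a' : A} {f f' g g'} → a ≡ a' → (∀ i → f i ≡ f' i) → (∀ j → g j ≡ g' j) →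
  ∀ v → caseV l r a f g v ≡ caseV l r a' f' g' v
caseV-cong l r {a} {a'} {f} {f'} {g} {g'} eq-a eq-f eq-g v with vertex l r v
... | atRoot = eq-a
... | inLeft i = trans (caseV-inL l r a f g i) (trans (eq-f i) (sym (caseV-inL l r a' f' g' i)))
... | inRight j = trans (caseV-inR l r a f g j) (trans (eq-g j) (sym (caseV-inR l r a' f' g' j)))

caseV-map : ∀ {A B : Set} l r (h : A → B) {a f g} v → h (caseV l r a f g v) ≡ caseV l r (h a) (h ∘ f) (h ∘ g) v
caseV-map l r h zero = refl
caseV-map l r h (suc j) with splitAt (size l) j
... | inj₁ _ = refl
... | inj₂ _ = refl

edgeSum : ∀ {k} → List (Fin k × Fin k) → (Fin k × Fin k → ℕ) → Fin k → ℕ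
edgeSum [] g v = 0
edgeSum ((a , b) ∷ E) g v = (if does (a F.≟ v) ∨ does (b F.≟ v) then g (a , b) else 0) + edgeSum E g v

incSum-lookup : ∀ {k} (E : List (Fin k × Fin k)) g v → incSum E (λ i → g (lookup E i)) v ≡ edgeSum E g v
incSum-lookup [] g v = refl
incSum-lookup ((a , b) ∷ E) g v = cong (_ +_) (incSum-lookup E g v)

edgeSum-++ : ∀ {k} (E E' : List (Fin k × Fin k)) g v → edgeSum (E ++ E') g v ≡ edgeSum E g v + edgeSum E' g v
edgeSum-++ [] E' g v = refl
edgeSum-++ ((a , b) ∷ E) E' g v =
  trans (cong (_ +_) (edgeSum-++ E E' g v)) (sym (+-assoc (if does (a F.≟ v) ∨ does (b F.≟ v) then g (a , b) else 0) _ _))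

edgeSum-cong : ∀ {k} {E : List (Fin k × Fin k)} {g g'} → All (λ e → g e ≡ g' e) E → ∀ v → edgeSum E g v ≡ edgeSum E g' v
edgeSum-cong [] v = refl
edgeSum-cong (eq ∷ eqs) v = cong₂ _+_ (cong (λ x → if _ then x else 0) eq) (edgeSum-cong eqs v)

liftEdge : ∀ {m n} → (Fin m → Fin n) → Fin m × Fin m → Fin n × Fin n
liftEdge f (a , b) = f a , f b

edgeSum-map : ∀ {m n} (f : Fin m → Fin n) (E : List (Fin m × Fin m)) g {v v'} →
  (∀ a → does (f a F.≟ v) ≡ does (a F.≟ v')) → edgeSum (map (liftEdge f) E) g v ≡ edgeSum E (g ∘ liftEdge f) v'
edgeSum-map f [] g same = refl
edgeSum-map f ((a , b) ∷ E) g same rewrite same a | same b = cong (_ +_) (edgeSum-map f E g same)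

edgeSum-map-away : ∀ {m n} (f : Fin m → Fin n) (E : List (Fin m × Fin m)) g {v} →
  (∀ a → does (f a F.≟ v) ≡ false) → edgeSum (map (liftEdge f) E) g v ≡ 0
edgeSum-map-away f [] g away = refl
edgeSum-map-away f ((a , b) ∷ E) g away rewrite away a | away b = edgeSum-map-away f E g away

edgeSum-root : ∀ l r g → edgeSum (treeEdges (node l r)) g zero ≡ g (zero , inL l r (root l)) + g (zero , inR l r (root r))
edgeSum-root l r g = begin
    g e₁ + (g e₂ + edgeSum (map (liftEdge (inL l r)) (treeEdges l) ++ map (liftEdge (inR l r)) (treeEdges r)) g zero)
      ≡⟨ cong (λ x → g e₁ + (g e₂ + x)) (edgeSum-++ (map (liftEdge (inL l r)) (treeEdges l)) _ g zero) ⟩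
    g e₁ + (g e₂ + (edgeSum (map (liftEdge (inL l r)) (treeEdges l)) g zero + edgeSum (map (liftEdge (inR l r)) (treeEdges r)) g zero))
      ≡⟨ cong (λ x → g e₁ + (g e₂ + x)) (cong₂ _+_ (edgeSum-map-away (inL l r) (treeEdges l) g λ _ → refl)
                                                 (edgeSum-map-away (inR l r) (treeEdges r) g λ _ → refl)) ⟩
    g e₁ + (g e₂ + 0)
      ≡⟨ cong (g e₁ +_) (+-identityʳ (g e₂)) ⟩
    g e₁ + g e₂ ∎
  where
  open ≡-Reasoning
  e₁ = zero , inL l r (root l)
  e₂ = zero , inR l r (root r)

edgeSum-inL : ∀ l r g i → edgeSum (treeEdges (node l r)) g (inL l r i)
  ≡ (if does (root l F.≟ i) then g (zero , inL l r (root l)) else 0) + edgeSum (treeEdges l) (g ∘ liftEdge (inL l r)) i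
edgeSum-inL l r g i = begin
    (if does (inL l r (root l) F.≟ inL l r i) then g e₁ else 0)
      + ((if does (inR l r (root r) F.≟ inL l r i) then g e₂ else 0) + edgeSum (Eₗ ++ Eᵣ) g (inL l r i))
      ≡⟨ cong₂ (λ x y → (if x then g e₁ else 0) + ((if y then g e₂ else 0) + edgeSum (Eₗ ++ Eᵣ) g (inL l r i)))
               (does-injective (inL l r) (inL-injective l r) (root l) i)
               (dec-false (inR l r (root r) F.≟ inL l r i) (inL≢inR l r i (root r) ∘ sym)) ⟩
    (if does (root l F.≟ i) then g e₁ else 0) + edgeSum (Eₗ ++ Eᵣ) g (inL l r i)
      ≡⟨ cong (here +_) (edgeSum-++ Eₗ Eᵣ g (inL l r i)) ⟩
    (if does (root l F.≟ i) then g e₁ else 0) + (edgeSum Eₗ g (inL l r i) + edgeSum Eᵣ g (inL l r i))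
      ≡⟨ cong (here +_) (cong₂ _+_
           (edgeSum-map (inL l r) (treeEdges l) g {inL l r i} {i} λ a → does-injective (inL l r) (inL-injective l r) a i)
           (edgeSum-map-away (inR l r) (treeEdges r) g {inL l r i} λ b → dec-false (inR l r b F.≟ inL l r i) (inL≢inR l r i b ∘ sym))) ⟩
    (if does (root l F.≟ i) then g e₁ else 0) + (edgeSum (treeEdges l) (g ∘ liftEdge (inL l r)) i + 0)
      ≡⟨ cong (here +_) (+-identityʳ _) ⟩
    (if does (root l F.≟ i) then g e₁ else 0) + edgeSum (treeEdges l) (g ∘ liftEdge (inL l r)) i ∎
  where
  open ≡-Reasoning
  e₁ = zero , inL l r (root l)
  e₂ = zero , inR l r (root r)
  Eₗ = map (liftEdge (inL l r)) (treeEdges l)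
  Eᵣ = map (liftEdge (inR l r)) (treeEdges r)
  here = if does (root l F.≟ i) then g e₁ else 0

edgeSum-inR : ∀ l r g j → edgeSum (treeEdges (node l r)) g (inR l r j)
  ≡ (if does (root r F.≟ j) then g (zero , inR l r (root r)) else 0) + edgeSum (treeEdges r) (g ∘ liftEdge (inR l r)) j
edgeSum-inR l r g j = begin
    (if does (inL l r (root l) F.≟ inR l r j) then g e₁ else 0)
      + ((if does (inR l r (root r) F.≟ inR l r j) then g e₂ else 0) + edgeSum (Eₗ ++ Eᵣ) g (inR l r j))
      ≡⟨ cong₂ (λ x y → (if x then g e₁ else 0) + ((if y then g e₂ else 0) + edgeSum (Eₗ ++ Eᵣ) g (inR l r j)))
               (dec-false (inL l r (root l) F.≟ inR l r j) (inL≢inR l r (root l) j))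
               (does-injective (inR l r) (inR-injective l r) (root r) j) ⟩
    (if does (root r F.≟ j) then g e₂ else 0) + edgeSum (Eₗ ++ Eᵣ) g (inR l r j)
      ≡⟨ cong (here +_) (edgeSum-++ Eₗ Eᵣ g (inR l r j)) ⟩
    (if does (root r F.≟ j) then g e₂ else 0) + (edgeSum Eₗ g (inR l r j) + edgeSum Eᵣ g (inR l r j))
      ≡⟨ cong (here +_) (cong₂ _+_
           (edgeSum-map-away (inL l r) (treeEdges l) g {inR l r j} λ a → dec-false (inL l r a F.≟ inR l r j) (inL≢inR l r a j))
           (edgeSum-map (inR l r) (treeEdges r) g {inR l r j} {j} λ b → does-injective (inR l r) (inR-injective l r) b j)) ⟩
    (if does (root r F.≟ j) then g e₂ else 0) + edgeSum (treeEdges r) (g ∘ liftEdge (inR l r)) j ∎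
  where
  open ≡-Reasoning
  e₁ = zero , inL l r (root l)
  e₂ = zero , inR l r (root r)
  Eₗ = map (liftEdge (inL l r)) (treeEdges l)
  Eᵣ = map (liftEdge (inR l r)) (treeEdges r)
  here = if does (root r F.≟ j) then g e₂ else 0

-- Up-weights: u x is the weight of the edge joining x to its parent.  Then
-- load t u v = u v + Σ_{x child of v} u x  is the total up-weight seen at v
-- (counting u at the root as the weight of an edge above the tree).
load : (t : BTree) → (Fin (size t) → ℕ) → Fin (size t) → ℕ
rootLoad : ∀ l r → (Fin (size (node l r)) → ℕ) → ℕ

load leaf u = u
load (node l r) u = caseV l r (rootLoad l r u) (load l (u ∘ inL l r)) (load r (u ∘ inR l r))

rootLoad l r u = u (inL l r (root l)) + u (inR l r (root r)) + u zero

if-≟ : ∀ {n} (a v : Fin n) (h : Fin n → ℕ) →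
  (if does (a F.≟ v) then h a else 0) ≡ (if does (a F.≟ v) then h v else 0)
if-≟ a v h with a F.≟ v
... | yes refl = refl
... | no _ = refl

edgeSum-load : ∀ t u v → edgeSum (treeEdges t) (u ∘ proj₂) v + (if does (root t F.≟ v) then u v else 0) ≡ load t u v
edgeSum-load leaf u zero = refl
edgeSum-load (node l r) u v with vertex l r v
... | atRoot = cong (_+ u zero) (edgeSum-root l r (u ∘ proj₂))
... | inLeft i = begin
    edgeSum (treeEdges (node l r)) (u ∘ proj₂) (inL l r i) + 0
      ≡⟨ +-identityʳ _ ⟩
    edgeSum (treeEdges (node l r)) (u ∘ proj₂) (inL l r i)
      ≡⟨ edgeSum-inL l r (u ∘ proj₂) i ⟩
    (if does (root l F.≟ i) then uₗ (root l) else 0) + edgeSum (treeEdges l) (uₗ ∘ proj₂) i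
      ≡⟨ cong (_+ edgeSum (treeEdges l) (uₗ ∘ proj₂) i) (if-≟ (root l) i uₗ) ⟩
    (if does (root l F.≟ i) then uₗ i else 0) + edgeSum (treeEdges l) (uₗ ∘ proj₂) i
      ≡⟨ +-comm (if does (root l F.≟ i) then uₗ i else 0) _ ⟩
    edgeSum (treeEdges l) (uₗ ∘ proj₂) i + (if does (root l F.≟ i) then uₗ i else 0)
      ≡⟨ edgeSum-load l uₗ i ⟩
    load l uₗ i
      ≡⟨ sym (caseV-inL l r (rootLoad l r u) (load l uₗ) (load r (u ∘ inR l r)) i) ⟩
    load (node l r) u (inL l r i) ∎
  where
  open ≡-Reasoning
  uₗ = u ∘ inL l r
... | inRight j = begin
    edgeSum (treeEdges (node l r)) (u ∘ proj₂) (inR l r j) + 0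
      ≡⟨ +-identityʳ _ ⟩
    edgeSum (treeEdges (node l r)) (u ∘ proj₂) (inR l r j)
      ≡⟨ edgeSum-inR l r (u ∘ proj₂) j ⟩
    (if does (root r F.≟ j) then uᵣ (root r) else 0) + edgeSum (treeEdges r) (uᵣ ∘ proj₂) j
      ≡⟨ cong (_+ edgeSum (treeEdges r) (uᵣ ∘ proj₂) j) (if-≟ (root r) j uᵣ) ⟩
    (if does (root r F.≟ j) then uᵣ j else 0) + edgeSum (treeEdges r) (uᵣ ∘ proj₂) j
      ≡⟨ +-comm (if does (root r F.≟ j) then uᵣ j else 0) _ ⟩
    edgeSum (treeEdges r) (uᵣ ∘ proj₂) j + (if does (root r F.≟ j) then uᵣ j else 0)
      ≡⟨ edgeSum-load r uᵣ j ⟩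
    load r uᵣ j
      ≡⟨ sym (caseV-inR l r (rootLoad l r u) (load l (u ∘ inL l r)) (load r uᵣ) j) ⟩
    load (node l r) u (inR l r j) ∎
  where
  open ≡-Reasoning
  uᵣ = u ∘ inR l r

edgeSum≡load : ∀ t u → u (root t) ≡ 0 → ∀ v → edgeSum (treeEdges t) (u ∘ proj₂) v ≡ load t u v
edgeSum≡load t u u-root v with root t F.≟ v | edgeSum-load t u v
... | yes refl | eq = trans (sym (trans (cong (edgeSum (treeEdges t) (u ∘ proj₂) (root t) +_) u-root) (+-identityʳ _))) eq
... | no _ | eq = trans (sym (+-identityʳ _)) eq

mkW : ∀ t → (wv wu : Fin (size t) → ℕ) → TotalWeighting (treeGraph t)
mkW t wv wu = record { wV = wv ; wE = λ i → wu (proj₂ (lookup (treeEdges t) i)) }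

wt-mkW : ∀ t wv wu → wu (root t) ≡ 0 → ∀ v → wt {treeGraph t} (mkW t wv wu) v ≡ wv v + load t wu v
wt-mkW t wv wu wu-root v =
  cong (wv v +_) (trans (incSum-lookup (treeEdges t) (wu ∘ proj₂) v) (edgeSum≡load t wu wu-root v))

load-cong : ∀ t {u u'} → (∀ x → u x ≡ u' x) → ∀ v → load t u v ≡ load t u' v
load-cong leaf eq v = eq v
load-cong (node l r) eq = caseV-cong l r
  (cong₂ _+_ (cong₂ _+_ (eq (inL l r (root l))) (eq (inR l r (root r)))) (eq zero))
  (load-cong l (eq ∘ inL l r)) (load-cong r (eq ∘ inR l r))

load-node : ∀ l r (w₀ u₀ : ℕ) wl wr ul ur v →
  caseV l r w₀ wl wr v + load (node l r) (caseV l r u₀ ul ur) v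
  ≡ caseV l r (w₀ + (ul (root l) + ur (root r) + u₀)) (λ i → wl i + load l ul i) (λ j → wr j + load r ur j) v
load-node l r w₀ u₀ wl wr ul ur v with vertex l r v
... | atRoot = cong (λ z → w₀ + (z + u₀)) (cong₂ _+_ (caseV-inL l r u₀ ul ur (root l)) (caseV-inR l r u₀ ul ur (root r)))
... | inLeft i = begin
    caseV l r w₀ wl wr (inL l r i) + load (node l r) u (inL l r i)
      ≡⟨ cong₂ _+_ (caseV-inL l r w₀ wl wr i) (caseV-inL l r (rootLoad l r u) (load l (u ∘ inL l r)) (load r (u ∘ inR l r)) i) ⟩
    wl i + load l (u ∘ inL l r) i
      ≡⟨ cong (wl i +_) (load-cong l (caseV-inL l r u₀ ul ur) i) ⟩
    wl i + load l ul i
      ≡⟨ sym (caseV-inL l r (w₀ + (ul (root l) + ur (root r) + u₀)) (λ i → wl i + load l ul i) (λ j → wr j + load r ur j) i) ⟩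
    caseV l r (w₀ + (ul (root l) + ur (root r) + u₀)) (λ i → wl i + load l ul i) (λ j → wr j + load r ur j) (inL l r i) ∎
  where
  open ≡-Reasoning
  u = caseV l r u₀ ul ur
... | inRight j = begin
    caseV l r w₀ wl wr (inR l r j) + load (node l r) u (inR l r j)
      ≡⟨ cong₂ _+_ (caseV-inR l r w₀ wl wr j) (caseV-inR l r (rootLoad l r u) (load l (u ∘ inL l r)) (load r (u ∘ inR l r)) j) ⟩
    wr j + load r (u ∘ inR l r) j
      ≡⟨ cong (wr j +_) (load-cong r (caseV-inR l r u₀ ul ur) j) ⟩
    wr j + load r ur j
      ≡⟨ sym (caseV-inR l r (w₀ + (ul (root l) + ur (root r) + u₀)) (λ i → wl i + load l ul i) (λ j → wr j + load r ur j) j) ⟩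
    caseV l r (w₀ + (ul (root l) + ur (root r) + u₀)) (λ i → wl i + load l ul i) (λ j → wr j + load r ur j) (inR l r j) ∎
  where
  open ≡-Reasoning
  u = caseV l r u₀ ul ur

-- Edges of a tree are listed as (parent , child), so the root is never the child.
children-nonroot : ∀ l r → All (λ e → proj₂ e ≢ zero) (treeEdges (node l r))
children-nonroot l r = (λ ()) ∷ (λ ()) ∷ AllP.++⁺ (AllP.map⁺ (All.universal (λ _ ()) (treeEdges l)))
                                                  (AllP.map⁺ (All.universal (λ _ ()) (treeEdges r)))

mkW-labels : ∀ l r s wv wu → (∀ v → Bounded s (wv v)) → (∀ x → x ≢ zero → Bounded s (wu x)) →
  LabelsIn {treeGraph (node l r)} s (mkW (node l r) wv wu)
mkW-labels l r s wv wu bv bu =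
  bv , λ i → bu _ (All.lookup (children-nonroot l r) (∈-lookup {xs = treeEdges (node l r)} i))

upUnit : ∀ {n} → Fin n → ℕ
upUnit zero = 0
upUnit (suc _) = 1

degree-load : ∀ l r v → degree (treeGraph (node l r)) v ≡ load (node l r) upUnit v
degree-load l r v = begin
    degree (treeGraph (node l r)) v
      ≡⟨ incSum-lookup (treeEdges (node l r)) (λ _ → 1) v ⟩
    edgeSum (treeEdges (node l r)) (λ _ → 1) v
      ≡⟨ edgeSum-cong (All.map (λ {e} → unit {e}) (children-nonroot l r)) v ⟩
    edgeSum (treeEdges (node l r)) (upUnit ∘ proj₂) v
      ≡⟨ edgeSum≡load (node l r) upUnit refl v ⟩
    load (node l r) upUnit v ∎
  where
  open ≡-Reasoning
  unit : ∀ {e : Fin (size (node l r)) × Fin (size (node l r))} → proj₂ e ≢ zero → 1 ≡ upUnit (proj₂ e)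
  unit {_ , zero} ne = ⊥-elim (ne refl)
  unit {_ , suc _} ne = refl

count : (n : ℕ) → (Fin n → Bool) → ℕ
count zero P = 0
count (suc n) P = (if P zero then 1 else 0) + count n (P ∘ suc)

length-filter : ∀ {A : Set} {P : A → Set} (P? : ∀ x → Dec (P x)) n (g : Fin n → A) →
  length (filter P? (tabulate g)) ≡ count n (λ x → does (P? (g x)))
length-filter P? zero g = refl
length-filter P? (suc n) g with does (P? (g zero))
... | true = cong suc (length-filter P? n (g ∘ suc))
... | false = length-filter P? n (g ∘ suc)

count-cong : ∀ n {P Q : Fin n → Bool} → (∀ x → P x ≡ Q x) → count n P ≡ count n Q
count-cong zero eq = refl
count-cong (suc n) eq = cong₂ _+_ (cong (λ b → if b then 1 else 0) (eq zero)) (count-cong n (eq ∘ suc))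

count-+ : ∀ m n P → count (m + n) P ≡ count m (λ i → P (i ↑ˡ n)) + count n (λ j → P (m ↑ʳ j))
count-+ zero n P = refl
count-+ (suc m) n P =
  trans (cong ((if P zero then 1 else 0) +_) (count-+ m n (P ∘ suc))) (sym (+-assoc (if P zero then 1 else 0) _ _))

count-load : ∀ l r u (Q : ℕ → Bool) → count (size (node l r)) (Q ∘ load (node l r) u)
  ≡ (if Q (rootLoad l r u) then 1 else 0) + (count (size l) (Q ∘ load l (u ∘ inL l r)) + count (size r) (Q ∘ load r (u ∘ inR l r)))
count-load l r u Q = cong ((if Q (rootLoad l r u) then 1 else 0) +_) (trans (count-+ (size l) (size r) _)
  (cong₂ _+_ (count-cong (size l) λ i → cong Q (caseV-inL l r (rootLoad l r u) (load l (u ∘ inL l r)) (load r (u ∘ inR l r)) i))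
             (count-cong (size r) λ j → cong Q (caseV-inR l r (rootLoad l r u) (load l (u ∘ inL l r)) (load r (u ∘ inR l r)) j))))

isOne : ℕ → Bool
isOne x = does (x ≟ 1)

leaves : BTree → ℕ
leaves leaf = 1
leaves (node l r) = leaves l + leaves r

-- Below an edge of unit weight, leaves have load 1 and internal vertices load 3.
count-pendant : ∀ t → count (size t) (isOne ∘ load t (λ _ → 1)) ≡ leaves t
count-pendant leaf = refl
count-pendant (node l r) = trans (count-load l r (λ _ → 1) isOne) (cong₂ _+_ (count-pendant l) (count-pendant r))

n₁-node : ∀ l r → n₁ (treeGraph (node l r)) ≡ leaves l + leaves r
n₁-node l r = begin
    n₁ (treeGraph (node l r))
      ≡⟨ length-filter (λ v → degree (treeGraph (node l r)) v ≟ 1) (size (node l r)) (λ v → v) ⟩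
    count (size (node l r)) (isOne ∘ degree (treeGraph (node l r)))
      ≡⟨ count-cong (size (node l r)) (cong isOne ∘ degree-load l r) ⟩
    count (size (node l r)) (isOne ∘ load (node l r) upUnit)
      ≡⟨ count-load l r upUnit isOne ⟩
    count (size l) (isOne ∘ load l (λ _ → 1)) + count (size r) (isOne ∘ load r (λ _ → 1))
      ≡⟨ cong₂ _+_ (count-pendant l) (count-pendant r) ⟩
    leaves l + leaves r ∎
  where open ≡-Reasoning

cherries twigs forks : BTree → ℕ
cherries leaf = 0
cherries (node leaf leaf) = 1
cherries (node leaf (node a b)) = cherries (node a b)
cherries (node (node a b) leaf) = cherries (node a b)
cherries (node (node a b) (node c d)) = cherries (node a b) + cherries (node c d)

twigs leaf = 0
twigs (node leaf leaf) = 0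
twigs (node leaf (node a b)) = suc (twigs (node a b))
twigs (node (node a b) leaf) = suc (twigs (node a b))
twigs (node (node a b) (node c d)) = twigs (node a b) + twigs (node c d)

forks leaf = 0
forks (node leaf leaf) = 0
forks (node leaf (node a b)) = forks (node a b)
forks (node (node a b) leaf) = forks (node a b)
forks (node (node a b) (node c d)) = suc (forks (node a b) + forks (node c d))

-- Codes of the non-root vertices in the construction: a cherry leaf is coded by
-- its intended weighted degree (2, 3, …, 2c+1); every other vertex by its class
-- and its index within the class.
data Code : Set where
  cherryLeaf twigLeaf cherry twig fork : ℕ → Code

-- Assigning the codes: the cherries, twigs and forks of node l r are numbered
-- consecutively from q, i and p, in the order root, left subtree, right subtree.
code : ∀ l r → (q i p : ℕ) → Fin (size (node l r)) → Code
code leaf leaf q i p = caseV leaf leaf (cherry q) (λ _ → cherryLeaf (q + q)) (λ _ → cherryLeaf (suc q + q))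
code leaf (node a b) q i p = caseV leaf (node a b) (twig i) (λ _ → twigLeaf i) (code a b q (suc i) p)
code (node a b) leaf q i p = caseV (node a b) leaf (twig i) (code a b q (suc i) p) (λ _ → twigLeaf i)
code (node a b) (node c d) q i p = caseV (node a b) (node c d) (fork p)
  (code a b q i (suc p)) (code c d (q + cherries (node a b)) (i + twigs (node a b)) (suc p + forks (node a b)))

-- Up-weights of cherry leaves: ⌊2q/2⌋ = ⌊(2q+1)/2⌋ = q.
⌊n+n/2⌋≡n : ∀ n → ⌊ n + n /2⌋ ≡ n
⌊n+n/2⌋≡n zero = refl
⌊n+n/2⌋≡n (suc n) = trans (cong (⌊_/2⌋ ∘ suc) (+-suc n n)) (cong suc (⌊n+n/2⌋≡n n))

-- The construction for a tree with k = 2c + m leaves, c cherries and m twigs,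
-- with labels in [1, s] where k < 2s.
module Construction (k s c m : ℕ) (k≡ : k ≡ c + c + m) (k<2s : suc k ≤ s + s) where

  -- The twig leaf i gets weighted degree target i = k + 2 - i, split between its
  -- vertex weight leafW i and the weight leafUp i of its edge.
  target leafW leafUp twigW : ℕ → ℕ
  target i = k + 2 ∸ i
  leafW i = suc c ⊔ (target i ∸ s)
  leafUp i = target i ∸ leafW i
  twigW i = leafW i ∸ c

  -- The weight table: vertex weight, weight of the edge to the parent, and total
  -- weight of the edges to the children, for a vertex with a given code.
  vw uw childUp : Code → ℕ
  vw (cherryLeaf x) = ⌈ x /2⌉
  vw (twigLeaf i) = leafW i
  vw (cherry q) = s + 1 ∸ q
  vw (twig i) = twigW i
  vw (fork p) = s + 1 ∸ p

  uw (cherryLeaf x) = ⌊ x /2⌋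
  uw (twigLeaf i) = leafUp i
  uw (cherry q) = s
  uw (twig i) = s
  uw (fork p) = s

  childUp (cherryLeaf x) = 0
  childUp (twigLeaf i) = 0
  childUp (cherry q) = q + q
  childUp (twig i) = leafUp i + s
  childUp (fork p) = s + s

  val : Code → ℕ
  val x = vw x + (childUp x + uw x)

  Valued : ∀ t → (Fin (size t) → Code) → Set
  Valued t cd = ∀ v → vw (cd v) + load t (uw ∘ cd) v ≡ val (cd v)

  valued-node : ∀ l r x₀ {cl cr} → uw (cl (root l)) + uw (cr (root r)) ≡ childUp x₀ →
    Valued l cl → Valued r cr → Valued (node l r) (caseV l r x₀ cl cr)
  valued-node l r x₀ {cl} {cr} up valued-l valued-r v = begin
      vw (caseV l r x₀ cl cr v) + load (node l r) (uw ∘ caseV l r x₀ cl cr) v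
        ≡⟨ cong₂ _+_ (caseV-map l r vw v) (load-cong (node l r) (λ x → caseV-map l r uw {x₀} {cl} {cr} x) v) ⟩
      caseV l r (vw x₀) (vw ∘ cl) (vw ∘ cr) v + load (node l r) (caseV l r (uw x₀) (uw ∘ cl) (uw ∘ cr)) v
        ≡⟨ load-node l r (vw x₀) (uw x₀) (vw ∘ cl) (vw ∘ cr) (uw ∘ cl) (uw ∘ cr) v ⟩
      caseV l r (vw x₀ + (uw (cl (root l)) + uw (cr (root r)) + uw x₀))
                (λ i → vw (cl i) + load l (uw ∘ cl) i) (λ j → vw (cr j) + load r (uw ∘ cr) j) v
        ≡⟨ caseV-cong l r (cong (λ z → vw x₀ + (z + uw x₀)) up) valued-l valued-r v ⟩
      caseV l r (val x₀) (val ∘ cl) (val ∘ cr) v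
        ≡⟨ sym (caseV-map l r val v) ⟩
      val (caseV l r x₀ cl cr v) ∎
    where open ≡-Reasoning

  code-root-up : ∀ a b q i p → uw (code a b q i p zero) ≡ s
  code-root-up leaf leaf q i p = refl
  code-root-up leaf (node _ _) q i p = refl
  code-root-up (node _ _) leaf q i p = refl
  code-root-up (node _ _) (node _ _) q i p = refl

  cherry-up : ∀ q → ⌊ q + q /2⌋ + ⌊ suc q + q /2⌋ ≡ q + q
  cherry-up q = cong₂ _+_ (⌊n+n/2⌋≡n q) (sym (n≡⌈n+n/2⌉ q))

  code-valued : ∀ a b q i p → Valued (node a b) (code a b q i p)
  code-valued leaf leaf q i p =
    valued-node leaf leaf (cherry q) (cherry-up q) (λ { zero → refl }) (λ { zero → refl })
  code-valued leaf (node a b) q i p =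
    valued-node leaf (node a b) (twig i) (cong (leafUp i +_) (code-root-up a b q (suc i) p))
      (λ { zero → refl }) (code-valued a b q (suc i) p)
  code-valued (node a b) leaf q i p =
    valued-node (node a b) leaf (twig i) (trans (cong (_+ leafUp i) (code-root-up a b q (suc i) p)) (+-comm s (leafUp i)))
      (code-valued a b q (suc i) p) (λ { zero → refl })
  code-valued (node a b) (node c d) q i p =
    valued-node (node a b) (node c d) (fork p) (cong₂ _+_ (code-root-up a b q i (suc p)) (code-root-up c d _ _ _))
      (code-valued a b q i (suc p)) (code-valued c d _ _ _)

  InRange : (q i p q' i' p' : ℕ) → Code → Set
  InRange q i p q' i' p' (cherryLeaf x) = q + q ≤ x × x < q' + q'
  InRange q i p q' i' p' (twigLeaf x) = i ≤ x × x < i'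
  InRange q i p q' i' p' (cherry x) = q ≤ x × x < q'
  InRange q i p q' i' p' (twig x) = i ≤ x × x < i'
  InRange q i p q' i' p' (fork x) = p ≤ x × x < p'

  widen : ∀ {q i p q' i' p' q₂ i₂ p₂ q₂' i₂' p₂'} x → InRange q i p q' i' p' x →
    q₂ ≤ q → i₂ ≤ i → p₂ ≤ p → q' ≤ q₂' → i' ≤ i₂' → p' ≤ p₂' → InRange q₂ i₂ p₂ q₂' i₂' p₂' x
  widen (cherryLeaf x) (lo , hi) q₂≤q _ _ q'≤ _ _ = ≤-trans (+-mono-≤ q₂≤q q₂≤q) lo , ≤-trans hi (+-mono-≤ q'≤ q'≤)
  widen (twigLeaf x) (lo , hi) _ i₂≤i _ _ i'≤ _ = ≤-trans i₂≤i lo , ≤-trans hi i'≤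
  widen (cherry x) (lo , hi) q₂≤q _ _ q'≤ _ _ = ≤-trans q₂≤q lo , ≤-trans hi q'≤
  widen (twig x) (lo , hi) _ i₂≤i _ _ i'≤ _ = ≤-trans i₂≤i lo , ≤-trans hi i'≤
  widen (fork x) (lo , hi) _ _ p₂≤p _ _ p'≤ = ≤-trans p₂≤p lo , ≤-trans hi p'≤

  disjoint : ∀ {q i p q' i' p' q₂ i₂ p₂ q₂' i₂' p₂'} x → InRange q i p q' i' p' x → InRange q₂ i₂ p₂ q₂' i₂' p₂' x →
    q' ≤ q₂ → i' ≤ i₂ → p' ≤ p₂ → ⊥
  disjoint (cherryLeaf x) (_ , hi) (lo , _) q' i' p' = <⇒≱ hi (≤-trans (+-mono-≤ q' q') lo)
  disjoint (twigLeaf x) (_ , hi) (lo , _) q' i' p' = <⇒≱ hi (≤-trans i' lo)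
  disjoint (cherry x) (_ , hi) (lo , _) q' i' p' = <⇒≱ hi (≤-trans q' lo)
  disjoint (twig x) (_ , hi) (lo , _) q' i' p' = <⇒≱ hi (≤-trans i' lo)
  disjoint (fork x) (_ , hi) (lo , _) q' i' p' = <⇒≱ hi (≤-trans p' lo)

  below-twig : ∀ {q i p q' i' p' x j} → InRange q i p q' i' p' x → j < i → x ≢ twig j
  below-twig (lo , _) j<i refl = <⇒≱ j<i lo

  below-twigLeaf : ∀ {q i p q' i' p' x j} → InRange q i p q' i' p' x → j < i → x ≢ twigLeaf j
  below-twigLeaf (lo , _) j<i refl = <⇒≱ j<i lo

  below-fork : ∀ {q i p q' i' p' x j} → InRange q i p q' i' p' x → j < p → x ≢ fork j
  below-fork (lo , _) j<p refl = <⇒≱ j<p lo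

  <+suc : ∀ a b → a < a + suc b
  <+suc a b = ≤-trans (s≤s (m≤m+n a b)) (≤-reflexive (sym (+-suc a b)))

  code-range : ∀ a b q i p v →
    InRange q i p (q + cherries (node a b)) (i + twigs (node a b)) (p + forks (node a b)) (code a b q i p v)
  code-range leaf leaf q i p = caseV-all (InRange q i p (q + 1) (i + 0) (p + 0)) leaf leaf
    (≤-refl , ≤-reflexive (+-comm 1 q)) (λ _ → ≤-refl , ≤-trans (n≤1+n _) cherry-bound) (λ _ → n≤1+n _ , cherry-bound)
    where
    cherry-bound : suc (q + q) < q + 1 + (q + 1)
    cherry-bound rewrite +-comm q 1 | +-suc q q = ≤-refl
  code-range leaf (node a b) q i p = caseV-all (InRange q i p _ _ _) leaf (node a b)
    (≤-refl , <+suc i _) (λ _ → ≤-refl , <+suc i _)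
    (λ j → widen (code a b q (suc i) p j) (code-range a b q (suc i) p j)
             ≤-refl (n≤1+n i) ≤-refl ≤-refl (≤-reflexive (sym (+-suc i _))) ≤-refl)
  code-range (node a b) leaf q i p = caseV-all (InRange q i p _ _ _) (node a b) leaf
    (≤-refl , <+suc i _)
    (λ j → widen (code a b q (suc i) p j) (code-range a b q (suc i) p j)
             ≤-refl (n≤1+n i) ≤-refl ≤-refl (≤-reflexive (sym (+-suc i _))) ≤-refl)
    (λ _ → ≤-refl , <+suc i _)
  code-range (node a b) (node c d) q i p = caseV-all (InRange q i p _ _ _) (node a b) (node c d)
    (≤-refl , <+suc p _)
    (λ j → widen (code a b q i (suc p) j) (code-range a b q i (suc p) j)
             ≤-refl ≤-refl (n≤1+n p) (+-monoʳ-≤ q (m≤m+n _ _)) (+-monoʳ-≤ i (m≤m+n _ _))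
             (≤-trans (+-monoʳ-≤ (suc p) (m≤m+n _ (forks (node c d)))) (≤-reflexive (sym (+-suc p _)))))
    (λ j → widen (code c d _ _ _ j) (code-range c d _ _ _ j)
             (m≤m+n q _) (m≤m+n i _) (≤-trans (n≤1+n p) (m≤m+n (suc p) _))
             (≤-reflexive (+-assoc q _ _)) (≤-reflexive (+-assoc i _ _))
             (≤-reflexive (trans (+-assoc (suc p) _ _) (sym (+-suc p _)))))

  constant-injective : ∀ {A : Set} {a : A} → Injective _≡_ _≡_ (λ (_ : Fin (size leaf)) → a)
  constant-injective {x = zero} {y = zero} _ = refl

  cherryLeaf-injective : ∀ {x y} → cherryLeaf x ≡ cherryLeaf y → x ≡ y
  cherryLeaf-injective refl = refl

  code-injective : ∀ a b q i p → Injective _≡_ _≡_ (code a b q i p)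
  code-injective leaf leaf q i p = caseV-injective leaf leaf constant-injective constant-injective
    (λ _ ()) (λ _ ()) (λ _ _ eq → 1+n≢n (sym (cherryLeaf-injective eq)))
  code-injective leaf (node a b) q i p = caseV-injective leaf (node a b) constant-injective (code-injective a b q (suc i) p)
    (λ _ ()) (λ j → below-twig (code-range a b q (suc i) p j) ≤-refl)
    (λ _ j eq → below-twigLeaf (code-range a b q (suc i) p j) ≤-refl (sym eq))
  code-injective (node a b) leaf q i p = caseV-injective (node a b) leaf (code-injective a b q (suc i) p) constant-injective
    (λ j → below-twig (code-range a b q (suc i) p j) ≤-refl) (λ _ ())
    (λ j _ eq → below-twigLeaf (code-range a b q (suc i) p j) ≤-refl eq)
  code-injective (node a b) (node c d) q i p = caseV-injective (node a b) (node c d)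
    (code-injective a b q i (suc p)) (code-injective c d _ _ _)
    (λ j → below-fork (code-range a b q i (suc p) j) ≤-refl)
    (λ j → below-fork (code-range c d _ _ _ j) (s≤s (m≤m+n p _)))
    (λ j j' eq → disjoint (code a b q i (suc p) j) (code-range a b q i (suc p) j)
                   (subst (InRange _ _ _ _ _ _) (sym eq) (code-range c d _ _ _ j')) ≤-refl ≤-refl ≤-refl)

  Good : Code → Set
  Good (cherryLeaf x) = 2 ≤ x × x ≤ suc (c + c)
  Good (twigLeaf i) = 1 ≤ i × i ≤ m
  Good (cherry q) = 1 ≤ q × q ≤ c
  Good (twig i) = 1 ≤ i × i ≤ m
  Good (fork p) = 1 ≤ p × p < c

  range-good : ∀ {q i p q' i' p'} x → InRange q i p q' i' p' x →
    1 ≤ q → q' ≤ suc c → 1 ≤ i → i' ≤ suc m → 1 ≤ p → p' ≤ c → Good x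
  range-good (cherryLeaf x) (lo , hi) 1≤q q'≤ _ _ _ _ =
    ≤-trans (+-mono-≤ 1≤q 1≤q) lo , s≤s⁻¹ (≤-trans hi (≤-trans (+-mono-≤ q'≤ q'≤) (≤-reflexive (cong suc (+-suc c c)))))
  range-good (twigLeaf x) (lo , hi) _ _ 1≤i i'≤ _ _ = ≤-trans 1≤i lo , s≤s⁻¹ (≤-trans hi i'≤)
  range-good (cherry x) (lo , hi) 1≤q q'≤ _ _ _ _ = ≤-trans 1≤q lo , s≤s⁻¹ (≤-trans hi q'≤)
  range-good (twig x) (lo , hi) _ _ 1≤i i'≤ _ _ = ≤-trans 1≤i lo , s≤s⁻¹ (≤-trans hi i'≤)
  range-good (fork x) (lo , hi) _ _ _ _ 1≤p p'≤ = ≤-trans 1≤p lo , ≤-trans hi p'≤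

  2c≤k : c + c ≤ k
  2c≤k = subst (c + c ≤_) (sym k≡) (m≤m+n (c + c) m)

  c<s : c < s
  c<s with s ≤? c
  ... | yes s≤c = ⊥-elim (<⇒≱ (≤-trans (s≤s 2c≤k) k<2s) (+-mono-≤ s≤c s≤c))
  ... | no s≰c = ≰⇒> s≰c

  1≤s : 1 ≤ s
  1≤s = ≤-trans (s≤s z≤n) c<s

  -- Twig arithmetic, for a twig index 1 ≤ i ≤ m: its leaf aims at a value in
  -- [2c+2, k+1], which splits into a leaf weight in [c+1, s] and an edge weight in [1, s].
  target+i : ∀ i → i ≤ m → target i + i ≡ k + 2
  target+i i i≤m = m∸n+n≡m (≤-trans i≤m (≤-trans (m≤n+m m (c + c)) (≤-trans (≤-reflexive (sym k≡)) (m≤m+n k 2))))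

  target-low : ∀ i → i ≤ m → suc (suc (c + c)) ≤ target i
  target-low i i≤m = +-cancelʳ-≤ i _ _ (begin
      suc (suc (c + c)) + i   ≤⟨ +-monoʳ-≤ (suc (suc (c + c))) i≤m ⟩
      suc (suc (c + c)) + m   ≡⟨ +-comm 2 (c + c + m) ⟩
      c + c + m + 2           ≡⟨ cong (_+ 2) (sym k≡) ⟩
      k + 2                   ≡⟨ sym (target+i i i≤m) ⟩
      target i + i            ∎)
    where open ≤-Reasoning

  target-high : ∀ i → 1 ≤ i → i ≤ m → target i ≤ suc k
  target-high i 1≤i i≤m = subst (target i ≤_) (+-comm k 1) (+-cancelʳ-≤ 1 _ _ (begin
      target i + 1   ≤⟨ +-monoʳ-≤ (target i) 1≤i ⟩
      target i + i   ≡⟨ target+i i i≤m ⟩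
      k + 2          ≡⟨ sym (+-assoc k 1 1) ⟩
      k + 1 + 1      ∎))
    where open ≤-Reasoning

  leafW-low : ∀ i → suc c ≤ leafW i
  leafW-low i = m≤m⊔n (suc c) (target i ∸ s)

  leafW-high : ∀ i → 1 ≤ i → i ≤ m → leafW i ≤ s
  leafW-high i 1≤i i≤m =
    ⊔-lub c<s (≤-trans (∸-monoˡ-≤ s (≤-trans (target-high i 1≤i i≤m) k<2s)) (≤-reflexive (m+n∸n≡m s s)))

  leafW<target : ∀ i → i ≤ m → leafW i < target i
  leafW<target i i≤m = ⊔-lub (≤-trans (s≤s (s≤s (m≤m+n c c))) (target-low i i≤m)) (∸-shrinks 1≤s (≤-trans (s≤s z≤n) (target-low i i≤m)))
    where
    ∸-shrinks : ∀ {x y} → 1 ≤ y → 1 ≤ x → x ∸ y < x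
    ∸-shrinks {suc x} {suc y} _ _ = s≤s (m∸n≤m x y)

  leafW+leafUp : ∀ i → i ≤ m → leafW i + leafUp i ≡ target i
  leafW+leafUp i i≤m = m+[n∸m]≡n (<⇒≤ (leafW<target i i≤m))

  twigW+leafUp : ∀ i → i ≤ m → twigW i + leafUp i + c ≡ target i
  twigW+leafUp i i≤m = begin
      twigW i + leafUp i + c     ≡⟨ +-assoc (twigW i) (leafUp i) c ⟩
      twigW i + (leafUp i + c)   ≡⟨ cong (twigW i +_) (+-comm (leafUp i) c) ⟩
      twigW i + (c + leafUp i)   ≡⟨ sym (+-assoc (twigW i) c (leafUp i)) ⟩
      twigW i + c + leafUp i     ≡⟨ cong (_+ leafUp i) (m∸n+n≡m (≤-trans (n≤1+n c) (leafW-low i))) ⟩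
      leafW i + leafUp i         ≡⟨ leafW+leafUp i i≤m ⟩
      target i                   ∎
    where open ≡-Reasoning

  s+1∸-bounded : ∀ x → 1 ≤ x → x ≤ s → Bounded s (s + 1 ∸ x)
  s+1∸-bounded x 1≤x x≤s = subst (1 ≤_) (sym (+-∸-comm 1 {x} x≤s)) (m≤n+m 1 (s ∸ x))
                         , ≤-trans (∸-monoʳ-≤ (s + 1) 1≤x) (≤-reflexive (m+n∸n≡m s 1))

  weights-bounded : ∀ x → Good x → Bounded s (vw x) × Bounded s (uw x)
  weights-bounded (cherryLeaf x) (2≤x , x≤) =
    (⌈n/2⌉-mono 2≤x , ≤-trans (⌈n/2⌉-mono x≤) (≤-trans (≤-reflexive (cong suc (⌊n+n/2⌋≡n c))) c<s)) ,
    (⌊n/2⌋-mono 2≤x , ≤-trans (⌊n/2⌋-mono x≤) (≤-trans (≤-reflexive (sym (n≡⌈n+n/2⌉ c))) (<⇒≤ c<s)))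
  weights-bounded (twigLeaf i) (1≤i , i≤m) =
    (≤-trans (s≤s z≤n) (leafW-low i) , leafW-high i 1≤i i≤m) ,
    (m<n⇒0<n∸m (leafW<target i i≤m) , leafUp≤s)
    where
    leafUp≤s : leafUp i ≤ s
    leafUp≤s = m≤n+o⇒m∸n≤o (target i) (leafW i)
      (≤-trans (m≤n+m∸n (target i) s) (≤-trans (+-monoʳ-≤ s (m≤n⊔m (suc c) _)) (≤-reflexive (+-comm s (leafW i)))))
  weights-bounded (cherry q) (1≤q , q≤c) = s+1∸-bounded q 1≤q (≤-trans q≤c (<⇒≤ c<s)) , (1≤s , ≤-refl)
  weights-bounded (twig i) (1≤i , i≤m) =
    (≤-trans (≤-reflexive (sym (trans (+-∸-assoc 1 {c} ≤-refl) (cong suc (n∸n≡0 c))))) (∸-monoˡ-≤ c (leafW-low i))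
      , ≤-trans (m∸n≤m (leafW i) c) (leafW-high i 1≤i i≤m)) ,
    (1≤s , ≤-refl)
  weights-bounded (fork p) (1≤p , p<c) = s+1∸-bounded p 1≤p (≤-trans (<⇒≤ p<c) (<⇒≤ c<s)) , (1≤s , ≤-refl)

  -- The weighted degrees of good codes fall into consecutive windows:
  -- cherry leaves ≤ 2c+1 < twig leaves ≤ k+1 < root value 2s+1 < cherries ≤ 2s+1+c
  -- < twigs ≤ 2s+k+1-c < forks, and inside each window the index can be read off.
  cherryLeafMax twigLeafMax rootVal cherryMax twigMax : ℕ
  cherryLeafMax = suc (c + c)
  twigLeafMax = suc k
  rootVal = suc (s + s)
  cherryMax = rootVal + c
  twigMax = s + s + suc k ∸ c

  decode : ℕ → Maybe Code
  decode n =
    if n ≤ᵇ cherryLeafMax then just (cherryLeaf n)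
    else if n ≤ᵇ twigLeafMax then just (twigLeaf (k + 2 ∸ n))
    else if n ≤ᵇ rootVal then nothing
    else if n ≤ᵇ cherryMax then just (cherry (n ∸ rootVal))
    else if n ≤ᵇ twigMax then just (twig (s + s + (k + 2) ∸ c ∸ n))
    else just (fork (s + s + s + s + 1 ∸ n))

  ≤ᵇ-true : ∀ {n b} → n ≤ b → (n ≤ᵇ b) ≡ true
  ≤ᵇ-true {n} {b} n≤b with n ≤ᵇ b | ≤⇒≤ᵇ n≤b
  ... | true | _ = refl

  ≤ᵇ-false : ∀ {n b} → b < n → (n ≤ᵇ b) ≡ false
  ≤ᵇ-false {n} {b} b<n with n ≤ᵇ b in eq
  ... | false = refl
  ... | true = ⊥-elim (<⇒≱ b<n (≤ᵇ⇒≤ n b (subst T (sym eq) tt)))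

  window₁ : cherryLeafMax ≤ twigLeafMax
  window₁ = s≤s 2c≤k
  window₂ : twigLeafMax ≤ rootVal
  window₂ = s≤s (≤-trans (n≤1+n k) k<2s)
  window₃ : rootVal ≤ cherryMax
  window₃ = m≤m+n rootVal c
  window₄ : cherryMax ≤ twigMax
  window₄ = m+n≤o⇒m≤o∸n cherryMax (begin
      suc (s + s) + c + c     ≡⟨ +-assoc (suc (s + s)) c c ⟩
      suc (s + s) + (c + c)   ≤⟨ +-monoʳ-≤ (suc (s + s)) 2c≤k ⟩
      suc (s + s + k)         ≡⟨ sym (+-suc (s + s) k) ⟩
      s + s + suc k           ∎)
    where open ≤-Reasoning

  decode-cherryLeaf : ∀ n → n ≤ cherryLeafMax → decode n ≡ just (cherryLeaf n)
  decode-cherryLeaf n h rewrite ≤ᵇ-true h = refl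

  decode-twigLeaf : ∀ n → cherryLeafMax < n → n ≤ twigLeafMax → decode n ≡ just (twigLeaf (k + 2 ∸ n))
  decode-twigLeaf n h₀ h₁ rewrite ≤ᵇ-false h₀ | ≤ᵇ-true h₁ = refl

  decode-root : decode rootVal ≡ nothing
  decode-root rewrite ≤ᵇ-false (≤-trans (s≤s window₁) (s≤s k<2s)) | ≤ᵇ-false (s≤s k<2s) | ≤ᵇ-true (≤-refl {rootVal}) = refl

  decode-cherry : ∀ n → rootVal < n → n ≤ cherryMax → decode n ≡ just (cherry (n ∸ rootVal))
  decode-cherry n h₂ h₃
    rewrite ≤ᵇ-false (≤-trans (s≤s (≤-trans window₁ window₂)) h₂) | ≤ᵇ-false (≤-trans (s≤s window₂) h₂)
          | ≤ᵇ-false h₂ | ≤ᵇ-true h₃ = refl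

  decode-twig : ∀ n → cherryMax < n → n ≤ twigMax → decode n ≡ just (twig (s + s + (k + 2) ∸ c ∸ n))
  decode-twig n h₃ h₄
    rewrite ≤ᵇ-false (≤-trans (s≤s (≤-trans window₁ (≤-trans window₂ window₃))) h₃)
          | ≤ᵇ-false (≤-trans (s≤s (≤-trans window₂ window₃)) h₃)
          | ≤ᵇ-false (≤-trans (s≤s window₃) h₃) | ≤ᵇ-false h₃ | ≤ᵇ-true h₄ = refl

  decode-fork : ∀ n → twigMax < n → decode n ≡ just (fork (s + s + s + s + 1 ∸ n))
  decode-fork n h₄
    rewrite ≤ᵇ-false (≤-trans (s≤s (≤-trans window₁ (≤-trans window₂ (≤-trans window₃ window₄)))) h₄)
          | ≤ᵇ-false (≤-trans (s≤s (≤-trans window₂ (≤-trans window₃ window₄))) h₄)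
          | ≤ᵇ-false (≤-trans (s≤s (≤-trans window₃ window₄)) h₄)
          | ≤ᵇ-false (≤-trans (s≤s window₄) h₄) | ≤ᵇ-false h₄ = refl

  decode-twigLeaf-val : ∀ i → 1 ≤ i → i ≤ m → decode (val (twigLeaf i)) ≡ just (twigLeaf i)
  decode-twigLeaf-val i 1≤i i≤m = begin
      decode (leafW i + leafUp i)          ≡⟨ cong decode (leafW+leafUp i i≤m) ⟩
      decode (target i)                    ≡⟨ decode-twigLeaf (target i) (target-low i i≤m) (target-high i 1≤i i≤m) ⟩
      just (twigLeaf (k + 2 ∸ target i))   ≡⟨ cong (just ∘ twigLeaf) (trans (cong (_∸ target i) (sym (target+i i i≤m))) (m+n∸m≡n (target i) i)) ⟩
      just (twigLeaf i)                    ∎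
    where open ≡-Reasoning

  decode-cherry-val : ∀ q → 1 ≤ q → q ≤ c → decode (val (cherry q)) ≡ just (cherry q)
  decode-cherry-val q 1≤q q≤c = begin
      decode ((s + 1 ∸ q) + (q + q + s))   ≡⟨ cong decode value ⟩
      decode (rootVal + q)                 ≡⟨ decode-cherry (rootVal + q) (subst (_≤ rootVal + q) (+-comm rootVal 1) (+-monoʳ-≤ rootVal 1≤q))
                                                            (+-monoʳ-≤ rootVal q≤c) ⟩
      just (cherry (rootVal + q ∸ rootVal)) ≡⟨ cong (just ∘ cherry) (m+n∸m≡n rootVal q) ⟩
      just (cherry q)                      ∎
    where
    open ≡-Reasoning
    value : (s + 1 ∸ q) + (q + q + s) ≡ rootVal + q
    value = trans (solve 3 (λ a q s → a :+ (q :+ q :+ s) := (a :+ q) :+ (q :+ s)) refl (s + 1 ∸ q) q s)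
              (trans (cong (_+ (q + s)) (m∸n+n≡m (≤-trans q≤c (≤-trans (<⇒≤ c<s) (m≤m+n s 1)))))
                     (solve 2 (λ s q → (s :+ con 1) :+ (q :+ s) := con 1 :+ (s :+ s) :+ q) refl s q))

  decode-twig-val : ∀ i → 1 ≤ i → i ≤ m → decode (val (twig i)) ≡ just (twig i)
  decode-twig-val i 1≤i i≤m = begin
      decode (twigW i + (leafUp i + s + s))   ≡⟨ cong decode value ⟩
      decode (s + s + u)                      ≡⟨ decode-twig (s + s + u) above below ⟩
      just (twig (s + s + (k + 2) ∸ c ∸ (s + s + u)))  ≡⟨ cong (just ∘ twig) index ⟩
      just (twig i)                           ∎
    where
    open ≡-Reasoning
    u = target i ∸ c
    c≤target : c ≤ target i
    c≤target = ≤-trans (≤-trans (m≤m+n c c) (≤-trans (n≤1+n _) (n≤1+n _))) (target-low i i≤m)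
    value : twigW i + (leafUp i + s + s) ≡ s + s + u
    value = trans (solve 3 (λ w e s → w :+ (e :+ s :+ s) := s :+ s :+ (w :+ e)) refl (twigW i) (leafUp i) s)
              (cong (s + s +_) (trans (sym (m+n∸n≡m (twigW i + leafUp i) c)) (cong (_∸ c) (twigW+leafUp i i≤m))))
    above : cherryMax < s + s + u
    above = subst (_≤ s + s + u) (solve 2 (λ s c → s :+ s :+ (con 2 :+ c) := con 2 :+ (s :+ s :+ c)) refl s c)
              (+-monoʳ-≤ (s + s) (subst (_≤ u) (m+n∸n≡m (suc (suc c)) c) (∸-monoˡ-≤ c (target-low i i≤m))))
    below : s + s + u ≤ twigMax
    below = m+n≤o⇒m≤o∸n (s + s + u) (≤-Reasoning.begin
        s + s + u + c     ≤-Reasoning.≡⟨ +-assoc (s + s) u c ⟩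
        s + s + (u + c)   ≤-Reasoning.≡⟨ cong (s + s +_) (m∸n+n≡m c≤target) ⟩
        s + s + target i  ≤-Reasoning.≤⟨ +-monoʳ-≤ (s + s) (target-high i 1≤i i≤m) ⟩
        s + s + suc k     ≤-Reasoning.∎)
    index : s + s + (k + 2) ∸ c ∸ (s + s + u) ≡ i
    index = begin
        s + s + (k + 2) ∸ c ∸ (s + s + u)
          ≡⟨ cong (λ z → s + s + z ∸ c ∸ (s + s + u)) (sym (target+i i i≤m)) ⟩
        s + s + (target i + i) ∸ c ∸ (s + s + u)
          ≡⟨ cong (λ z → s + s + (z + i) ∸ c ∸ (s + s + u)) (sym (m∸n+n≡m c≤target)) ⟩
        s + s + (u + c + i) ∸ c ∸ (s + s + u)
          ≡⟨ cong (λ z → z ∸ c ∸ (s + s + u)) (solve 4 (λ s u c i → s :+ s :+ (u :+ c :+ i) := s :+ s :+ u :+ i :+ c) refl s u c i) ⟩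
        s + s + u + i + c ∸ c ∸ (s + s + u)
          ≡⟨ cong (_∸ (s + s + u)) (m+n∸n≡m (s + s + u + i) c) ⟩
        s + s + u + i ∸ (s + s + u)
          ≡⟨ m+n∸m≡n (s + s + u) i ⟩
        i ∎

  decode-fork-val : ∀ p → p < c → decode (val (fork p)) ≡ just (fork p)
  decode-fork-val p p<c = trans (decode-fork v above) (cong (just ∘ fork) (trans (cong (_∸ v) (sym v+p)) (m+n∸m≡n v p)))
    where
    v = (s + 1 ∸ p) + (s + s + s)
    v+p : v + p ≡ s + s + s + s + 1
    v+p = trans (solve 3 (λ a s p → a :+ (s :+ s :+ s) :+ p := (a :+ p) :+ (s :+ s :+ s)) refl (s + 1 ∸ p) s p)
            (trans (cong (_+ (s + s + s)) (m∸n+n≡m (≤-trans (<⇒≤ p<c) (≤-trans (<⇒≤ c<s) (m≤m+n s 1)))))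
                   (solve 1 (λ s → (s :+ con 1) :+ (s :+ s :+ s) := s :+ s :+ s :+ s :+ con 1) refl s))
    above : twigMax < v
    above = +-cancelʳ-≤ c (suc twigMax) v (begin
        suc twigMax + c          ≡⟨ cong suc (m∸n+n≡m (≤-trans (m≤m+n c c) (≤-trans 2c≤k (≤-trans (n≤1+n k) (m≤n+m (suc k) (s + s)))))) ⟩
        suc (s + s + suc k)      ≤⟨ s≤s (+-monoʳ-≤ (s + s) k<2s) ⟩
        suc (s + s + (s + s))    ≡⟨ solve 1 (λ s → con 1 :+ (s :+ s :+ (s :+ s)) := s :+ s :+ s :+ s :+ con 1) refl s ⟩
        s + s + s + s + 1        ≡⟨ sym v+p ⟩
        v + p                    ≤⟨ +-monoʳ-≤ v (<⇒≤ p<c) ⟩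
        v + c                    ∎)
      where open ≤-Reasoning

  decode-val : ∀ x → Good x → decode (val x) ≡ just x
  decode-val (cherryLeaf x) (_ , x≤) = trans (cong decode (trans (+-comm ⌈ x /2⌉ _) (⌊n/2⌋+⌈n/2⌉≡n x))) (decode-cherryLeaf x x≤)
  decode-val (twigLeaf i) (1≤i , i≤m) = decode-twigLeaf-val i 1≤i i≤m
  decode-val (cherry q) (1≤q , q≤c) = decode-cherry-val q 1≤q q≤c
  decode-val (twig i) (1≤i , i≤m) = decode-twig-val i 1≤i i≤m
  decode-val (fork p) (_ , p<c) = decode-fork-val p p<c

  val-injective : ∀ {x y} → Good x → Good y → val x ≡ val y → x ≡ y
  val-injective {x} {y} gx gy eq = just-injective (trans (sym (decode-val x gx)) (trans (cong decode eq) (decode-val y gy)))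

  val≢rootVal : ∀ {x} → Good x → val x ≢ rootVal
  val≢rootVal {x} gx eq with () ← trans (sym (decode-val x gx)) (trans (cong decode eq) decode-root)

  -- The weighting of node l r assembled from codings of its subtrees: the root gets
  -- vertex weight rootVal minus the up-weights of its children, so its weighted
  -- degree is rootVal, and all other weighted degrees are values of good codes.
  assemble : ∀ l r (cl : Fin (size l) → Code) (cr : Fin (size r) → Code) →
    Valued l cl → Valued r cr → (∀ i → Good (cl i)) → (∀ j → Good (cr j)) →
    Injective _≡_ _≡_ cl → Injective _≡_ _≡_ cr → (∀ i j → cl i ≢ cr j) →
    suc s ≤ uw (cl (root l)) + uw (cr (root r)) → HasIrregularWeighting (treeGraph (node l r)) s
  assemble l r cl cr valued-l valued-r good-l good-r inj-l inj-r apart s<up =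
    mkW (node l r) wv wu , mkW-labels l r s wv wu bv bu , irregular
    where
    up = uw (cl (root l)) + uw (cr (root r))
    up≤2s : up ≤ s + s
    up≤2s = +-mono-≤ (proj₂ (proj₂ (weights-bounded _ (good-l (root l))))) (proj₂ (proj₂ (weights-bounded _ (good-r (root r)))))
    w₀ = rootVal ∸ up
    wv = caseV l r w₀ (vw ∘ cl) (vw ∘ cr)
    wu = caseV l r 0 (uw ∘ cl) (uw ∘ cr)

    w₀-bounded : Bounded s w₀
    w₀-bounded = m<n⇒0<n∸m (s≤s up≤2s) , m≤n+o⇒m∸n≤o rootVal up (+-monoˡ-≤ s s<up)

    bv : ∀ v → Bounded s (wv v)
    bv = caseV-all (Bounded s) l r w₀-bounded (λ i → proj₁ (weights-bounded _ (good-l i))) (λ j → proj₁ (weights-bounded _ (good-r j)))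

    bu : ∀ x → x ≢ zero → Bounded s (wu x)
    bu x x≢0 with vertex l r x
    ... | atRoot = ⊥-elim (x≢0 refl)
    ... | inLeft i = subst (Bounded s) (sym (caseV-inL l r 0 (uw ∘ cl) (uw ∘ cr) i)) (proj₂ (weights-bounded _ (good-l i)))
    ... | inRight j = subst (Bounded s) (sym (caseV-inR l r 0 (uw ∘ cl) (uw ∘ cr) j)) (proj₂ (weights-bounded _ (good-r j)))

    degrees : ∀ v → wt {treeGraph (node l r)} (mkW (node l r) wv wu) v ≡ caseV l r rootVal (val ∘ cl) (val ∘ cr) v
    degrees v = begin
        wt {treeGraph (node l r)} (mkW (node l r) wv wu) v
          ≡⟨ wt-mkW (node l r) wv wu refl v ⟩
        wv v + load (node l r) wu v
          ≡⟨ load-node l r w₀ 0 (vw ∘ cl) (vw ∘ cr) (uw ∘ cl) (uw ∘ cr) v ⟩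
        caseV l r (w₀ + (up + 0)) (λ i → vw (cl i) + load l (uw ∘ cl) i) (λ j → vw (cr j) + load r (uw ∘ cr) j) v
          ≡⟨ caseV-cong l r (trans (cong (w₀ +_) (+-identityʳ up)) (m∸n+n≡m (≤-trans up≤2s (n≤1+n _)))) valued-l valued-r v ⟩
        caseV l r rootVal (val ∘ cl) (val ∘ cr) v ∎
      where open ≡-Reasoning

    irregular : Irregular {treeGraph (node l r)} (mkW (node l r) wv wu)
    irregular u v eq = caseV-injective l r
      (inj-l ∘ val-injective (good-l _) (good-l _)) (inj-r ∘ val-injective (good-r _) (good-r _))
      (val≢rootVal ∘ good-l) (val≢rootVal ∘ good-r) (λ i j → apart i j ∘ val-injective (good-l i) (good-r j))
      (trans (sym (degrees u)) (trans eq (degrees v)))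

leaves-node : ∀ a b → leaves (node a b) ≡ cherries (node a b) + cherries (node a b) + twigs (node a b)
leaves-node leaf leaf = refl
leaves-node leaf (node a b) = trans (cong suc (leaves-node a b)) (sym (+-suc (cherries (node a b) + cherries (node a b)) _))
leaves-node (node a b) leaf = trans (cong (_+ 1) (leaves-node a b))
  (solve 2 (λ x y → x :+ x :+ y :+ con 1 := x :+ x :+ (con 1 :+ y)) refl (cherries (node a b)) (twigs (node a b)))
leaves-node (node a b) (node c d) = trans (cong₂ _+_ (leaves-node a b) (leaves-node c d))
  (solve 4 (λ x y z w → x :+ x :+ y :+ (z :+ z :+ w) := x :+ z :+ (x :+ z) :+ (y :+ w)) refl
     (cherries (node a b)) (twigs (node a b)) (cherries (node c d)) (twigs (node c d)))

forks+1 : ∀ a b → suc (forks (node a b)) ≡ cherries (node a b)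
forks+1 leaf leaf = refl
forks+1 leaf (node a b) = forks+1 a b
forks+1 (node a b) leaf = forks+1 a b
forks+1 (node a b) (node c d) =
  trans (cong suc (sym (+-suc (forks (node a b)) (forks (node c d))))) (cong₂ _+_ (forks+1 a b) (forks+1 c d))

n≤2⌈n/2⌉ : ∀ n → n ≤ ⌈ n /2⌉ + ⌈ n /2⌉
n≤2⌈n/2⌉ n = subst (_≤ ⌈ n /2⌉ + ⌈ n /2⌉) (⌊n/2⌋+⌈n/2⌉≡n n) (+-monoˡ-≤ ⌈ n /2⌉ (⌊n/2⌋≤⌈n/2⌉ n))

module TreeConstruction (k c m : ℕ) (k≡ : k ≡ c + c + m) =
  Construction k ⌈ suc k /2⌉ c m k≡ (n≤2⌈n/2⌉ (suc k))

twig-rooted-left : ∀ a b → HasIrregularWeighting (treeGraph (node leaf (node a b))) ⌈ suc (leaves (node leaf (node a b))) /2⌉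
twig-rooted-left a b = assemble leaf (node a b) (λ _ → twigLeaf 1) (code a b 1 2 1)
  (λ { zero → refl }) (code-valued a b 1 2 1) (λ _ → ≤-refl , s≤s z≤n) good constant-injective (code-injective a b 1 2 1)
  (λ _ j eq → below-twigLeaf (code-range a b 1 2 1 j) ≤-refl (sym eq))
  (subst (suc s ≤_) (cong (leafUp 1 +_) (sym (code-root-up a b 1 2 1)))
         (+-monoˡ-≤ s (proj₁ (proj₂ (weights-bounded (twigLeaf 1) (≤-refl , s≤s z≤n))))))
  where
  open TreeConstruction (leaves (node leaf (node a b))) (cherries (node a b)) (suc (twigs (node a b)))
    (trans (cong suc (leaves-node a b)) (sym (+-suc _ _)))
  s = ⌈ suc (leaves (node leaf (node a b))) /2⌉
  good : ∀ j → Good (code a b 1 2 1 j)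
  good j = range-good _ (code-range a b 1 2 1 j) ≤-refl ≤-refl (s≤s z≤n) ≤-refl ≤-refl (≤-reflexive (forks+1 a b))

twig-rooted-right : ∀ a b → HasIrregularWeighting (treeGraph (node (node a b) leaf)) ⌈ suc (leaves (node (node a b) leaf)) /2⌉
twig-rooted-right a b = assemble (node a b) leaf (code a b 1 2 1) (λ _ → twigLeaf 1)
  (code-valued a b 1 2 1) (λ { zero → refl }) good (λ _ → ≤-refl , s≤s z≤n) (code-injective a b 1 2 1) constant-injective
  (λ j _ eq → below-twigLeaf (code-range a b 1 2 1 j) ≤-refl eq)
  (subst (suc s ≤_) (trans (+-comm (leafUp 1) s) (cong (_+ leafUp 1) (sym (code-root-up a b 1 2 1))))
         (+-monoˡ-≤ s (proj₁ (proj₂ (weights-bounded (twigLeaf 1) (≤-refl , s≤s z≤n))))))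
  where
  open TreeConstruction (leaves (node (node a b) leaf)) (cherries (node a b)) (suc (twigs (node a b)))
    (trans (cong (_+ 1) (leaves-node a b))
      (solve 2 (λ x y → x :+ x :+ y :+ con 1 := x :+ x :+ (con 1 :+ y)) refl (cherries (node a b)) (twigs (node a b))))
  s = ⌈ suc (leaves (node (node a b) leaf)) /2⌉
  good : ∀ j → Good (code a b 1 2 1 j)
  good j = range-good _ (code-range a b 1 2 1 j) ≤-refl ≤-refl (s≤s z≤n) ≤-refl ≤-refl (≤-reflexive (forks+1 a b))

fork-rooted : ∀ a b c d → HasIrregularWeighting (treeGraph (node (node a b) (node c d))) ⌈ suc (leaves (node (node a b) (node c d))) /2⌉
fork-rooted a b c d = assemble L R (code a b 1 1 1) (code c d q i p)
  (code-valued a b 1 1 1) (code-valued c d q i p) good-l good-r (code-injective a b 1 1 1) (code-injective c d q i p)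
  (λ j j' eq → disjoint (code a b 1 1 1 j) (code-range a b 1 1 1 j)
                 (subst (InRange q i p _ _ _) (sym eq) (code-range c d q i p j')) ≤-refl ≤-refl ≤-refl)
  (subst (suc s ≤_) (sym (cong₂ _+_ (code-root-up a b 1 1 1) (code-root-up c d q i p))) (+-monoˡ-≤ s 1≤s))
  where
  L = node a b
  R = node c d
  q = 1 + cherries L
  i = 1 + twigs L
  p = 1 + forks L
  open TreeConstruction (leaves (node L R)) (cherries L + cherries R) (twigs L + twigs R)
    (trans (cong₂ _+_ (leaves-node a b) (leaves-node c d))
      (solve 4 (λ x y z w → x :+ x :+ y :+ (z :+ z :+ w) := x :+ z :+ (x :+ z) :+ (y :+ w)) refl
        (cherries L) (twigs L) (cherries R) (twigs R)))
  s = ⌈ suc (leaves (node L R)) /2⌉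
  good-l : ∀ j → Good (code a b 1 1 1 j)
  good-l j = range-good _ (code-range a b 1 1 1 j) ≤-refl (s≤s (m≤m+n _ _)) ≤-refl (s≤s (m≤m+n _ _))
    ≤-refl (≤-trans (≤-reflexive (forks+1 a b)) (m≤m+n _ _))
  good-r : ∀ j → Good (code c d q i p j)
  good-r j = range-good _ (code-range c d q i p j) (s≤s z≤n) ≤-refl (s≤s z≤n) ≤-refl (s≤s z≤n)
    (≤-trans (s≤s (+-monoʳ-≤ (forks L) (n≤1+n (forks R)))) (≤-reflexive (cong₂ _+_ (forks+1 a b) (forks+1 c d))))

-- The tree with two leaves, where assemble does not apply (the root would need
-- weight 3 > s = 2): weighted degrees 4 at the root and 2, 3 at the leaves.
cherry-weighting : HasIrregularWeighting (treeGraph (node leaf leaf)) 2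
cherry-weighting = mkW (node leaf leaf) wv wu , mkW-labels leaf leaf 2 wv wu bv bu , irregular
  where
  wv = caseV leaf leaf 2 (λ _ → 1) (λ _ → 2)
  wu = caseV leaf leaf 0 (λ _ → 1) (λ _ → 1)
  bv : ∀ v → Bounded 2 (wv v)
  bv = caseV-all (Bounded 2) leaf leaf (s≤s z≤n , ≤-refl) (λ _ → s≤s z≤n , s≤s z≤n) (λ _ → s≤s z≤n , ≤-refl)
  bu : ∀ x → x ≢ zero → Bounded 2 (wu x)
  bu zero x≢0 = ⊥-elim (x≢0 refl)
  bu (suc zero) _ = s≤s z≤n , s≤s z≤n
  bu (suc (suc zero)) _ = s≤s z≤n , s≤s z≤n
  irregular : Irregular {treeGraph (node leaf leaf)} (mkW (node leaf leaf) wv wu)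
  irregular zero zero _ = refl
  irregular (suc zero) (suc zero) _ = refl
  irregular (suc (suc zero)) (suc (suc zero)) _ = refl
  irregular zero (suc zero) ()
  irregular zero (suc (suc zero)) ()
  irregular (suc zero) zero ()
  irregular (suc zero) (suc (suc zero)) ()
  irregular (suc (suc zero)) zero ()
  irregular (suc (suc zero)) (suc zero) ()

single-vertex-weighting : HasIrregularWeighting (treeGraph leaf) 1
single-vertex-weighting = record { wV = λ _ → 1 ; wE = λ () } , ((λ _ → ≤-refl , ≤-refl) , λ ()) , λ { zero zero _ → refl }

node-weighting : ∀ l r → HasIrregularWeighting (treeGraph (node l r)) ⌈ suc (leaves (node l r)) /2⌉
node-weighting leaf leaf = cherry-weighting
node-weighting leaf (node a b) = twig-rooted-left a b
node-weighting (node a b) leaf = twig-rooted-right a b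
node-weighting (node a b) (node c d) = fork-rooted a b c d

upper-bound : ∀ T → HasIrregularWeighting (treeGraph T) ⌈ suc (n₁ (treeGraph T)) /2⌉
upper-bound leaf = single-vertex-weighting
upper-bound (node l r) =
  subst (λ k → HasIrregularWeighting (treeGraph (node l r)) ⌈ suc k /2⌉) (sym (n₁-node l r)) (node-weighting l r)

corollary1 : (T : BTree) → IsTvs (treeGraph T) ⌈ suc (n₁ (treeGraph T)) /2⌉
corollary1 T = upper-bound T , λ s → lower-bound (treeGraph T) (root T) s
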